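{- If a witness list is rooted, then it is path-structured.
   Context: A witness list on a finite set $\mathcal{V}$ is a sequence $L=(a_i,b_i,w_i)_{i\in[K]}$ in $\mathcal{V}^3$ with the pairs $(a_i,b_i)$ distinct, $a_i\ne b_i$, and such that whenever $w_i\ne b_i$ there exist $j_i,k_i\in[i-1]$ with $(a_i,w_i)=(a_{j_i},b_{j_i})$ and $(w_i,b_i)=(a_{k_i},b_{k_i})$. $\mathcal{E}_*(L)=\{(a_i,b_i)\}$, $\mathcal{E}(L)=\{(a_i,b_i): w_i=b_i\}$, and $\mathrm{wit}_L(a_i,b_i)=w_i$. $\mathrm{walk}_L(a_i,b_i)$ is $(a_i,b_i)$ if $w_i=b_i$, and otherwise the concatenation of $\mathrm{walk}_L(a_i,w_i)$ and $\mathrm{walk}_L(w_i,b_i)$; $L$ is path-structured if every $\mathrm{walk}_L(a_i,b_i)$ is a path. Recursively, $(a,b)\in\mathcal{E}_*(L)$ is $a$-out rooted if $(a,b)\in\mathcal{E}(L)$, or $(w,b)\in\mathcal{E}(L)$ and $(a,w)$ is $a$-out rooted, where $w=\mathrm{wit}_L(a,b)$; it is $b$-in rooted if $(a,b)\in\mathcal{E}(L)$, or $(a,w)\in\mathcal{E}(L)$ and $(w,b)$ is $b$-in rooted, where $w=\mathrm{wit}_L(a,b)$. $L$ is rooted if every $(a,b)\in\mathcal{E}_*(L)$ is $a$-out rooted or $b$-in rooted. -}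

module Defs where

open import Data.Nat using (ℕ)
open import Data.Fin using (Fin; _<_)
open import Data.List using (List; []; _∷_; _++_; drop)
open import Data.List.Relation.Unary.Unique.Propositional using (Unique)
open import Data.Sum using (_⊎_)
open import Data.Product using (Σ; ∃; ∃-syntax; _×_; _,_)
open import Relation.Binary.PropositionalEquality using (_≡_; _≢_)

-- A witness list of length K on the finite vertex set 𝒱 = Fin n is given by
-- three functions a b w : Fin K → Fin n ; entry i is (a i , b i , w i).
record IsWitnessList {n K : ℕ} (a b w : Fin K → Fin n) : Set where
  field
    pairs-distinct : ∀ i j → a i ≡ a j → b i ≡ b j → i ≡ j
    irreflexive    : ∀ i → a i ≢ b i
    witnessed      : ∀ i → w i ≢ b i →
                     ∃[ j ] ∃[ k ] (j < i × k < i ×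
                       (a j ≡ a i × b j ≡ w i) × (a k ≡ w i × b k ≡ b i))

module _ {n K : ℕ} (a b w : Fin K → Fin n) where

  -- Walk i p : p is walk_L(a_i , b_i), as a sequence of vertices.
  -- Concatenation of a walk ending at w with a walk starting at w:
  -- p ++ drop 1 q.
  data Walk : Fin K → List (Fin n) → Set where
    walk-edge  : ∀ {i} → w i ≡ b i → Walk i (a i ∷ b i ∷ [])
    walk-split : ∀ {i j k p q} → w i ≢ b i →
                 a j ≡ a i → b j ≡ w i → a k ≡ w i → b k ≡ b i →
                 Walk j p → Walk k q → Walk i (p ++ drop 1 q)

  PathStructured : Set
  PathStructured = ∀ i → ∃[ p ] (Walk i p × Unique p)

  -- (a,b) ∈ 𝓔(L), for the entry with index k.
  InE : Fin K → Set
  InE k = w k ≡ b k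

  data OutRooted : Fin K → Set where
    out-edge : ∀ {i} → InE i → OutRooted i
    out-step : ∀ {i j k} → w i ≢ b i →
               a k ≡ w i → b k ≡ b i → InE k →
               a j ≡ a i → b j ≡ w i → OutRooted j → OutRooted i

  data InRooted : Fin K → Set where
    in-edge : ∀ {i} → InE i → InRooted i
    in-step : ∀ {i j k} → w i ≢ b i →
              a j ≡ a i → b j ≡ w i → InE j →
              a k ≡ w i → b k ≡ b i → InRooted k → InRooted i

  Rooted : Set
  Rooted = ∀ i → OutRooted i ⊎ InRooted i

-- Along an a-out rooted pair (a, b) the walk is a followed by vertices x
-- that are the heads of earlier pairs (a, x); each unfolding appends the
-- head b of the current pair, which cannot occur before because the pairs
-- (a, x) with smaller index differ from (a, b) and a ≠ b.  Dually, the walk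
-- of a b-in rooted pair is b preceded by tails of earlier pairs (x, b).
module Submission where

open import Defs
open import Data.Nat using (ℕ)
open import Data.Nat.Properties using (≤-refl; ≤-trans; <⇒≤; ≤-<-trans)
open import Data.Fin using (Fin; _≤_; _<_)
open import Data.Fin.Properties using (<-irrefl)
open import Data.List using (List; []; _∷_; _∷ʳ_)
open import Data.List.Relation.Unary.All as All using (All; []; _∷_)
open import Data.List.Relation.Unary.All.Properties using (++⁺)
open import Data.List.Relation.Unary.AllPairs using ([]; _∷_)
import Data.List.Relation.Unary.AllPairs.Properties as AllPairs
open import Data.List.Relation.Unary.Unique.Propositional using (Unique)
open import Data.Sum using (_⊎_; inj₁; inj₂)
open import Data.Product using (∃-syntax; _×_; _,_)
open import Relation.Binary.PropositionalEquality

module _ {A : Set} where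

  Unique-∷ʳ : ∀ {xs : List A} {y} → Unique xs → All (_≢ y) xs → Unique (xs ∷ʳ y)
  Unique-∷ʳ xs! xs≢y = AllPairs.++⁺ xs! ([] ∷ []) (All.map (_∷ []) xs≢y)

module _ {n K : ℕ} {a b w : Fin K → Fin n} where

  Walk-head : ∀ {i p} → Walk a b w i p → ∃[ r ] p ≡ a i ∷ r
  Walk-head (walk-edge _) = _ , refl
  Walk-head (walk-split _ aj≡ai _ _ _ wj _) with Walk-head wj
  ... | _ , refl = _ , cong (_∷ _) aj≡ai

module WitnessListProperties {n K : ℕ} {a b w : Fin K → Fin n}
                             (L : IsWitnessList a b w) where
  open IsWitnessList L

  left-part-< : ∀ {i j} → w i ≢ b i → a j ≡ a i → b j ≡ w i → j < i
  left-part-< {i} {j} w≢b aj≡ai bj≡wi with witnessed i w≢b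
  ... | j′ , _ , j′<i , _ , (aj′≡ai , bj′≡wi) , _
    rewrite pairs-distinct j j′ (trans aj≡ai (sym aj′≡ai)) (trans bj≡wi (sym bj′≡wi))
    = j′<i

  right-part-< : ∀ {i k} → w i ≢ b i → a k ≡ w i → b k ≡ b i → k < i
  right-part-< {i} {k} w≢b ak≡wi bk≡bi with witnessed i w≢b
  ... | _ , k′ , _ , k′<i , _ , (ak′≡wi , bk′≡bi)
    rewrite pairs-distinct k k′ (trans ak≡wi (sym ak′≡wi)) (trans bk≡bi (sym bk′≡bi))
    = k′<i

  earlier-pair-≢ : ∀ {m i} → m < i → a m ≡ a i → b m ≢ b i
  earlier-pair-≢ {m} {i} m<i am≡ai bm≡bi with pairs-distinct m i am≡ai bm≡bi
  ... | refl = <-irrefl refl m<i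

  Unique-edge : ∀ i → Unique (a i ∷ b i ∷ [])
  Unique-edge i = (irreflexive i ∷ []) ∷ [] ∷ []

  OutVertex : Fin K → Fin n → Set
  OutVertex i x = x ≡ a i ⊎ ∃[ m ] (m ≤ i × a m ≡ a i × b m ≡ x)

  OutVertex-mono : ∀ {i j x} → j ≤ i → a j ≡ a i → OutVertex j x → OutVertex i x
  OutVertex-mono _ aj≡ai (inj₁ x≡aj) = inj₁ (trans x≡aj aj≡ai)
  OutVertex-mono j≤i aj≡ai (inj₂ (m , m≤j , am≡aj , bm≡x)) =
    inj₂ (m , ≤-trans m≤j j≤i , trans am≡aj aj≡ai , bm≡x)

  OutVertex-≢ : ∀ {i j x} → j < i → a j ≡ a i → OutVertex j x → x ≢ b i
  OutVertex-≢ {i} _ aj≡ai (inj₁ x≡aj) x≡bi = irreflexive i (trans (sym (trans x≡aj aj≡ai)) x≡bi)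
  OutVertex-≢ j<i aj≡ai (inj₂ (m , m≤j , am≡aj , bm≡x)) x≡bi =
    earlier-pair-≢ (≤-<-trans m≤j j<i) (trans am≡aj aj≡ai) (trans bm≡x x≡bi)

  OutRooted⇒path : ∀ {i} → OutRooted a b w i →
                   ∃[ p ] (Walk a b w i p × Unique p × All (OutVertex i) p)
  OutRooted⇒path {i} (out-edge wi≡bi) =
    _ , walk-edge wi≡bi , Unique-edge i , inj₁ refl ∷ inj₂ (i , ≤-refl , refl , refl) ∷ []
  OutRooted⇒path {i} (out-step {k = k} w≢b ak≡wi bk≡bi wk≡bk aj≡ai bj≡wi rooted)
    with OutRooted⇒path rooted
  ... | p , wj , p! , p∈out =
    p ∷ʳ b k ,
    walk-split w≢b aj≡ai bj≡wi ak≡wi bk≡bi wj (walk-edge wk≡bk) ,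
    Unique-∷ʳ p! (All.map (λ v x≡bk → OutVertex-≢ j<i aj≡ai v (trans x≡bk bk≡bi)) p∈out) ,
    ++⁺ (All.map (OutVertex-mono (<⇒≤ j<i) aj≡ai) p∈out)
        (inj₂ (i , ≤-refl , refl , sym bk≡bi) ∷ [])
    where j<i = left-part-< w≢b aj≡ai bj≡wi

  InVertex : Fin K → Fin n → Set
  InVertex i x = x ≡ b i ⊎ ∃[ m ] (m ≤ i × b m ≡ b i × a m ≡ x)

  InVertex-mono : ∀ {i k x} → k ≤ i → b k ≡ b i → InVertex k x → InVertex i x
  InVertex-mono _ bk≡bi (inj₁ x≡bk) = inj₁ (trans x≡bk bk≡bi)
  InVertex-mono k≤i bk≡bi (inj₂ (m , m≤k , bm≡bk , am≡x)) =
    inj₂ (m , ≤-trans m≤k k≤i , trans bm≡bk bk≡bi , am≡x)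

  InVertex-≢ : ∀ {i k x} → k < i → b k ≡ b i → InVertex k x → a i ≢ x
  InVertex-≢ {i} _ bk≡bi (inj₁ x≡bk) ai≡x = irreflexive i (trans ai≡x (trans x≡bk bk≡bi))
  InVertex-≢ k<i bk≡bi (inj₂ (m , m≤k , bm≡bk , am≡x)) ai≡x =
    earlier-pair-≢ (≤-<-trans m≤k k<i) (trans am≡x (sym ai≡x)) (trans bm≡bk bk≡bi)

  InRooted⇒path : ∀ {i} → InRooted a b w i →
                  ∃[ p ] (Walk a b w i p × Unique p × All (InVertex i) p)
  InRooted⇒path {i} (in-edge wi≡bi) =
    _ , walk-edge wi≡bi , Unique-edge i , inj₂ (i , ≤-refl , refl , refl) ∷ inj₁ refl ∷ []
  InRooted⇒path {i} (in-step {j = j} w≢b aj≡ai bj≡wi wj≡bj ak≡wi bk≡bi rooted)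
    with InRooted⇒path rooted
  ... | q , wk , q! , q∈in =
    a j ∷ q ,
    walk ,
    All.map (λ v aj≡x → InVertex-≢ k<i bk≡bi v (trans (sym aj≡ai) aj≡x)) q∈in ∷ q! ,
    inj₂ (i , ≤-refl , refl , sym aj≡ai) ∷ All.map (InVertex-mono (<⇒≤ k<i) bk≡bi) q∈in
    where
    k<i = right-part-< w≢b ak≡wi bk≡bi
    -- The walk of the right part starts at a k = w i = b j, so gluing it
    -- after the edge (a j, b j) drops exactly that repeated vertex.
    walk : Walk a b w i (a j ∷ q)
    walk with Walk-head wk
    ... | r , refl = subst (λ x → Walk a b w i (a j ∷ x ∷ r)) (trans bj≡wi (sym ak≡wi))
                       (walk-split w≢b aj≡ai bj≡wi ak≡wi bk≡bi (walk-edge wj≡bj) wk)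

lemma7p2 : ∀ {n K : ℕ} (a b w : Fin K → Fin n) →
    IsWitnessList a b w → Rooted a b w → PathStructured a b w
lemma7p2 a b w L rooted i = path (rooted i)
  where
  open WitnessListProperties L
  path : OutRooted a b w i ⊎ InRooted a b w i → ∃[ p ] (Walk a b w i p × Unique p)
  path (inj₁ out) = let (p , walk , p! , _) = OutRooted⇒path out in p , walk , p!
  path (inj₂ in′) = let (p , walk , p! , _) = InRooted⇒path in′ in p , walk , p!
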